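{- Let $S$ and $T$ be maximal expressible subsets of $[\![1,\ell]\!]$ and $\mathcal{V}_S$, $\mathcal{V}_T$ the corresponding irreducible components of $\mathcal{V}$. Then $\mathcal{V}_S\cap\mathcal{V}_T\ne\emptyset$ if and only if for every $m\in[\![0,n]\!]$, every $a\in S\cap I_m$ and every $b\in T\cap I_m$, we have $|a-b|\le1$.
   Context: Let $k_E$ be a field and $\ell\ge1$. On $(\mathbb{P}^1_{k_E})^\ell$ use homogeneous coordinates $[y_i:z_i]$. For each $j\in[\![1,\ell-1]\!]$ fix $t_j\in\{\searrow,\nearrow\}$: $t_j=\searrow$ imposes $y_jz_{j+1}=0$, $t_j=\nearrow$ imposes $z_jy_{j+1}=0$. Let $\mathcal{V}\subset(\mathbb{P}^1_{k_E})^\ell$ be the closed subvariety defined by these equations (factor variety of a sequence of alleles without loop). $j\in[\![2,\ell-1]\!]$ is an alternation of slope if $t_{j-1}\ne t_j$; let $j_1<\dots<j_n$ be these ($n=0$ if none), $j_0=1$, $j_{n+1}=\ell$, $I_m=[\![j_m,j_{m+1}]\!]$ for $m\in[\![0,n]\!]$. $S\subset[\![1,\ell]\!]$ is expressible if $\mathrm{Card}(S\cap I_m)\le1$ for all $m\in[\![0,n]\!]$. The irreducible components of $\mathcal{V}$ are in bijection with maximal expressible subsets; the component $\mathcal{V}_S$ attached to $S$ is the irreducible component on which the projection to the $i$-th factor $\mathbb{P}^1$ is non-constant exactly for $i\in S$ (it is isomorphic to $(\mathbb{P}^1)^{\mathrm{Card}\,S}$, the other coordinates being fixed equal to $[0:1]$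 or $[1:0]$). -}

module Defs where

open import Level using (Level; _⊔_) renaming (suc to lsuc)
open import Data.Nat using (ℕ; zero; suc; _+_; _∸_; _≤_; _<_)
open import Data.Bool using (Bool; true; false; if_then_else_)
open import Data.Product using (Σ; ∃; ∃-syntax; _×_; _,_; proj₁; proj₂)
open import Data.Sum using (_⊎_)
open import Relation.Nullary using (¬_)
open import Relation.Binary.PropositionalEquality using (_≡_)
open import Algebra.Bundles using (CommutativeRing)

record Field (c ℓ : Level) : Set (lsuc (c ⊔ ℓ)) where
  field
    commRing : CommutativeRing c ℓ
  open CommutativeRing commRing public
  field
    1≉0     : ¬ (1# ≈ 0#)
    inverse : ∀ x → ¬ (x ≈ 0#) → ∃[ y ] (x * y ≈ 1#)

-- Slopes and sequences of alleles without loop.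
-- Indices live in ℕ; only i ∈ [1,ℓ] (resp. j ∈ [1,ℓ-1] for slopes) matter.

data Slope : Set where
  ↘ ↗ : Slope

Alternation : (ℓ : ℕ) (t : ℕ → Slope) → ℕ → Set
Alternation ℓ t j = (2 ≤ j) × (j ≤ ℓ ∸ 1) × ¬ (t (j ∸ 1) ≡ t j)

Breakpoint : (ℓ : ℕ) (t : ℕ → Slope) → ℕ → Set
Breakpoint ℓ t j = (j ≡ 1) ⊎ ((j ≡ ℓ) ⊎ Alternation ℓ t j)

-- [p, q] is one of the intervals I_m = [j_m, j_{m+1}]:
-- p ≤ q are breakpoints with no breakpoint strictly between them.
-- (When ℓ ≥ 2 this also admits degenerate [p,p] for a breakpoint p,
--  which is contained in a genuine I_m, hence harmless; when ℓ = 1 it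
--  yields exactly I₀ = [1,1].)
IsInterval : (ℓ : ℕ) (t : ℕ → Slope) → ℕ → ℕ → Set
IsInterval ℓ t p q =
  Breakpoint ℓ t p × Breakpoint ℓ t q × p ≤ q ×
  (∀ r → p < r → r < q → ¬ Breakpoint ℓ t r)

InInterval : ℕ → ℕ → ℕ → Set
InInterval p q a = (p ≤ a) × (a ≤ q)

_∈ˢ_ : ℕ → (ℕ → Bool) → Set
i ∈ˢ S = S i ≡ true

SubsetOfRange : (ℓ : ℕ) → (ℕ → Bool) → Set
SubsetOfRange ℓ S = ∀ i → i ∈ˢ S → (1 ≤ i) × (i ≤ ℓ)

Expressible : (ℓ : ℕ) (t : ℕ → Slope) → (ℕ → Bool) → Set
Expressible ℓ t S =
  SubsetOfRange ℓ S ×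
  (∀ p q → IsInterval ℓ t p q →
     ∀ a b → a ∈ˢ S → b ∈ˢ S → InInterval p q a → InInterval p q b → a ≡ b)

MaximalExpressible : (ℓ : ℕ) (t : ℕ → Slope) → (ℕ → Bool) → Set
MaximalExpressible ℓ t S =
  Expressible ℓ t S ×
  (∀ S′ → Expressible ℓ t S′ → (∀ i → i ∈ˢ S → i ∈ˢ S′) → ∀ i → i ∈ˢ S′ → i ∈ˢ S)

-- Points of (ℙ¹)^ℓ over the field k, via homogeneous coordinates
-- [y_i : z_i] (representatives; all predicates below are invariant
-- under rescaling each coordinate pair, so no quotient is needed).

module _ {c r : Level} (k : Field c r) where
  open Field k

  Pt : Set c
  Pt = ℕ → Carrier × Carrier

  y z : Pt → ℕ → Carrier
  y P i = proj₁ (P i)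
  z P i = proj₂ (P i)

  IsPoint : ℕ → Pt → Set r
  IsPoint ℓ P = ∀ i → 1 ≤ i → i ≤ ℓ → ¬ ((y P i ≈ 0#) × (z P i ≈ 0#))

  SlopeEq : Slope → Pt → ℕ → Set r
  SlopeEq ↘ P j = y P j * z P (suc j) ≈ 0#
  SlopeEq ↗ P j = z P j * y P (suc j) ≈ 0#

  InV : (ℓ : ℕ) (t : ℕ → Slope) → Pt → Set r
  InV ℓ t P = IsPoint ℓ P × (∀ j → 1 ≤ j → j ≤ ℓ ∸ 1 → SlopeEq (t j) P j)

  replace : (ℕ → Bool) → Pt → Pt → Pt
  replace S P Q i = if S i then Q i else P i

  -- k-points of the component 𝒱_S: points of 𝒱 whose coordinates
  -- outside S are compatible with arbitrary coordinates on S, i.e.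
  -- 𝒱_S = (ℙ¹)^S × {the fixed values off S}.
  InVS : (ℓ : ℕ) (t : ℕ → Slope) → (ℕ → Bool) → Pt → Set (c ⊔ r)
  InVS ℓ t S P = InV ℓ t P × (∀ Q → IsPoint ℓ Q → InV ℓ t (replace S P Q))

{-# OPTIONS --safe #-}
-- Write the edge equation of slope s between the factors j and j + 1 as
-- λₛ(x_j) · ρₛ(x_{j+1}) = 0; a point lies on 𝒱_S when its edge equations
-- survive arbitrary values of the coordinates indexed by S.
--
-- If a ∈ S and b ∈ T lie in one interval with b ≥ a + 2, the slope is some
-- constant s between them. Freeing x_a forces ρₛ(x_{a+1}) = 0, which
-- propagates along the interval to ρₛ(x_{b-1}) = 0, while freeing x_b
-- forces λₛ(x_{b-1}) = 0: no point of ℙ¹ has both coordinates zero.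
--
-- Conversely, put x_j at the zero of λ_{t j} until an element of S ∪ T has
-- been passed within the current constant-slope run, and at the zero of
-- ρ_{t j} afterwards. At an alternation the zero of ρ for the old slope is
-- the zero of λ for the new one, so every edge equation holds, and freeing
-- S (or T) only breaks an equation when some element of S ∪ T sits two or
-- more steps left of an element of S (or T) in the same interval.
module Submission where

open import Defs
open import Level using (Level)
open import Data.Bool using (Bool; true; false; _∧_; _∨_; if_then_else_) renaming (_≟_ to _≟ᵇ_)
open import Data.Bool.Properties using (∨-zeroʳ; ∨-identityʳ)
open import Data.Nat
  using (ℕ; zero; suc; _+_; _≤_; _<_; _∸_; z≤n; s≤s; _≟_; _≤?_;
         _≤′_; ≤′-refl; ≤′-step; _≤‴_; ≤‴-refl; ≤‴-step)
open import Data.Nat.Properties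
  using (≤-refl; ≤-trans; <-trans; <-≤-trans; ≤-<-trans; <-irrefl; <⇒≤; <⇒≱;
         n≤1+n; n<1+n; m≤n⇒m≤1+n; m<n⇒m<1+n; m<1+n⇒m≤n; m≤n⇒m<n∨m≡n;
         m∸n≤m; n∸n≡0; ≤⇒≤′; ≤′⇒≤; ≤⇒≤‴)
open import Data.Product using (∃-syntax; _×_; _,_; proj₁; proj₂)
open import Data.Sum using (_⊎_; inj₁; inj₂; map₂)
open import Data.Empty using (⊥; ⊥-elim)
open import Relation.Nullary using (¬_; Dec; yes; no; does; contradiction)
open import Relation.Nullary.Decidable using (_⊎-dec_; _×-dec_; ¬?; decidable-stable)
open import Relation.Binary.Definitions using (DecidableEquality)
open import Relation.Binary.PropositionalEquality using (_≡_; refl; sym; trans; cong; subst; subst₂)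
open import Function.Bundles using (_⇔_; mk⇔)
import Relation.Binary.Reasoning.Setoid as ≈-Reasoning

m∸n≤1⊎2+n≤m : ∀ m n → m ∸ n ≤ 1 ⊎ 2 + n ≤ m
m∸n≤1⊎2+n≤m zero          zero    = inj₁ z≤n
m∸n≤1⊎2+n≤m zero          (suc n) = inj₁ z≤n
m∸n≤1⊎2+n≤m (suc zero)    zero    = inj₁ ≤-refl
m∸n≤1⊎2+n≤m (suc (suc m)) zero    = inj₂ (s≤s (s≤s z≤n))
m∸n≤1⊎2+n≤m (suc m)       (suc n) = map₂ s≤s (m∸n≤1⊎2+n≤m m n)

2+n≤m⇒m∸n≰1 : ∀ {m n} → 2 + n ≤ m → ¬ (m ∸ n ≤ 1)
2+n≤m⇒m∸n≰1 {n = zero}  (s≤s (s≤s _)) (s≤s ())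
2+n≤m⇒m∸n≰1 {n = suc n} (s≤s 2+n≤m)   = 2+n≤m⇒m∸n≰1 2+n≤m

<⇒≤∸1 : ∀ {m n} → m < n → m ≤ n ∸ 1
<⇒≤∸1 (s≤s m≤n) = m≤n

≤∸1⇒< : ∀ {m n} → 1 ≤ m → m ≤ n ∸ 1 → m < n
≤∸1⇒< {n = zero}  (s≤s z≤n) ()
≤∸1⇒< {n = suc n} _         m≤n = s≤s m≤n

_≟ˢ_ : DecidableEquality Slope
↘ ≟ˢ ↘ = yes refl
↘ ≟ˢ ↗ = no λ ()
↗ ≟ˢ ↘ = no λ ()
↗ ≟ˢ ↗ = yes refl

module Intervals (ℓ : ℕ) (t : ℕ → Slope) where

  NoBreakpointBetween : ℕ → ℕ → Set
  NoBreakpointBetween a b = ∀ r → a < r → r < b → ¬ Breakpoint ℓ t r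

  SameInterval : ℕ → ℕ → Set
  SameInterval a b = ∃[ p ] ∃[ q ] (IsInterval ℓ t p q × InInterval p q a × InInterval p q b)

  -- Close U X: within an interval, no element of X lies two or more steps to
  -- the right of an element of U (elements of U to its right are unconstrained).
  Close : (ℕ → Bool) → (ℕ → Bool) → Set
  Close U X = ∀ p q → IsInterval ℓ t p q → ∀ a b → a ∈ˢ U → b ∈ˢ X
            → InInterval p q a → InInterval p q b → b ∸ a ≤ 1

  WithinOne : (ℕ → Bool) → (ℕ → Bool) → Set
  WithinOne S T = ∀ p q → IsInterval ℓ t p q → ∀ a b → a ∈ˢ S → b ∈ˢ T
                → InInterval p q a → InInterval p q b → a ∸ b ≤ 1 × b ∸ a ≤ 1

  breakpoint? : ∀ j → Dec (Breakpoint ℓ t j)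
  breakpoint? j =
    j ≟ 1 ⊎-dec j ≟ ℓ ⊎-dec 2 ≤? j ×-dec j ≤? ℓ ∸ 1 ×-dec ¬? (t (j ∸ 1) ≟ˢ t j)

  breakpoint-bounds : 1 ≤ ℓ → ∀ {j} → Breakpoint ℓ t j → 1 ≤ j × j ≤ ℓ
  breakpoint-bounds 1≤ℓ (inj₁ refl)                       = ≤-refl , 1≤ℓ
  breakpoint-bounds 1≤ℓ (inj₂ (inj₁ refl))                = 1≤ℓ , ≤-refl
  breakpoint-bounds _   (inj₂ (inj₂ (2≤j , j≤ℓ∸1 , _))) =
    ≤-trans (n≤1+n 1) 2≤j , ≤-trans j≤ℓ∸1 (m∸n≤m ℓ 1)

  sameSlope⇒¬breakpoint : ∀ n → 2 + n < ℓ → t (suc n) ≡ t (2 + n) → ¬ Breakpoint ℓ t (2 + n)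
  sameSlope⇒¬breakpoint n 2+n<ℓ same (inj₂ (inj₁ refl))            = <-irrefl refl 2+n<ℓ
  sameSlope⇒¬breakpoint n 2+n<ℓ same (inj₂ (inj₂ (_ , _ , differ))) = differ same

  ¬breakpoint⇒sameSlope : ∀ {j} → 2 ≤ j → j ≤ ℓ ∸ 1 → ¬ Breakpoint ℓ t j → t (j ∸ 1) ≡ t j
  ¬breakpoint⇒sameSlope 2≤j j≤ℓ∸1 ¬bp =
    decidable-stable (t _ ≟ˢ t _) λ differ → ¬bp (inj₂ (inj₂ (2≤j , j≤ℓ∸1 , differ)))

  noBreakpointBetween-suc : ∀ a → NoBreakpointBetween a (suc a)
  noBreakpointBetween-suc a r a<r r<1+a _ = <⇒≱ a<r (m<1+n⇒m≤n r<1+a)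

  noBreakpointBetween-extendʳ : ∀ {a b} → NoBreakpointBetween a b → ¬ Breakpoint ℓ t b
                              → NoBreakpointBetween a (suc b)
  noBreakpointBetween-extendʳ nb ¬bp r a<r r<1+b with m≤n⇒m<n∨m≡n (m<1+n⇒m≤n r<1+b)
  ... | inj₁ r<b  = nb r a<r r<b
  ... | inj₂ refl = ¬bp

  noBreakpointBetween-extendˡ : ∀ {a b} → NoBreakpointBetween (suc a) b
                              → ¬ Breakpoint ℓ t (suc a) → NoBreakpointBetween a b
  noBreakpointBetween-extendˡ nb ¬bp r a<r r<b with m≤n⇒m<n∨m≡n a<r
  ... | inj₁ 1+a<r = nb r 1+a<r r<b
  ... | inj₂ refl  = ¬bp

  breakpoint-leftOf : ∀ {a b} → 1 ≤′ a → NoBreakpointBetween a b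
                    → ∃[ p ] (Breakpoint ℓ t p × p ≤ a × NoBreakpointBetween p b)
  breakpoint-leftOf ≤′-refl nb = 1 , inj₁ refl , ≤-refl , nb
  breakpoint-leftOf {suc a} (≤′-step 1≤a) nb with breakpoint? (suc a)
  ... | yes bp  = suc a , bp , ≤-refl , nb
  ... | no ¬bp with breakpoint-leftOf 1≤a (noBreakpointBetween-extendˡ nb ¬bp)
  ...   | p , bp , p≤a , nb′ = p , bp , m≤n⇒m≤1+n p≤a , nb′

  breakpoint-rightOf : ∀ {a b} → b ≤‴ ℓ → NoBreakpointBetween a b
                     → ∃[ q ] (Breakpoint ℓ t q × b ≤ q × NoBreakpointBetween a q)
  breakpoint-rightOf ≤‴-refl nb = ℓ , inj₂ (inj₁ refl) , ≤-refl , nb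
  breakpoint-rightOf {b = b} (≤‴-step 1+b≤ℓ) nb with breakpoint? b
  ... | yes bp  = b , bp , ≤-refl , nb
  ... | no ¬bp with breakpoint-rightOf 1+b≤ℓ (noBreakpointBetween-extendʳ nb ¬bp)
  ...   | q , bq , 1+b≤q , nb′ = q , bq , <⇒≤ 1+b≤q , nb′

  sameInterval : ∀ {a b} → 1 ≤ a → a ≤ b → b ≤ ℓ → NoBreakpointBetween a b → SameInterval a b
  sameInterval {a} 1≤a a≤b b≤ℓ nb with breakpoint-leftOf (≤⇒≤′ 1≤a) nb
  ... | p , bp , p≤a , nbp with breakpoint-rightOf (≤⇒≤‴ b≤ℓ) nbp
  ...   | q , bq , b≤q , nbpq =
    p , q , (bp , bq , ≤-trans p≤a a≤q , nbpq) , (p≤a , a≤q) , (≤-trans p≤a a≤b , b≤q)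
    where
    a≤q : a ≤ q
    a≤q = ≤-trans a≤b b≤q

  interval-slope : 1 ≤ ℓ → ∀ {p q} → IsInterval ℓ t p q → ∀ {i} → p ≤ i → i < q → t i ≡ t p
  interval-slope _ _ {zero} z≤n _ = refl
  interval-slope 1≤ℓ {p} I@(bp , bq , _ , nb) {suc i} p≤1+i 1+i<q with m≤n⇒m<n∨m≡n p≤1+i
  ... | inj₂ refl  = refl
  ... | inj₁ p<1+i = trans (sym same) (interval-slope 1≤ℓ I p≤i (<-trans (n<1+n i) 1+i<q))
    where
    p≤i : p ≤ i
    p≤i = m<1+n⇒m≤n p<1+i
    same : t i ≡ t (suc i)
    same = ¬breakpoint⇒sameSlope (s≤s (≤-trans (proj₁ (breakpoint-bounds 1≤ℓ bp)) p≤i))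
                                 (<⇒≤∸1 (<-≤-trans 1+i<q (proj₂ (breakpoint-bounds 1≤ℓ bq))))
                                 (nb (suc i) p<1+i 1+i<q)

  expressible⇒close : ∀ {X} → Expressible ℓ t X → Close X X
  expressible⇒close (_ , unique) p q I a b a∈X b∈X a∈I b∈I
    rewrite unique p q I a b a∈X b∈X a∈I b∈I | n∸n≡0 b = z≤n

  close-∪ : ∀ {U V X} → Close U X → Close V X → Close (λ i → U i ∨ V i) X
  close-∪ {U} closeU closeV p q I a b a∈U∪V b∈X a∈I b∈I with U a in a∈U
  ... | true  = closeU p q I a b a∈U b∈X a∈I b∈I
  ... | false = closeV p q I a b a∈U∪V b∈X a∈I b∈I

  expressible⇒¬adjacent : ∀ {X j} → Expressible ℓ t X → 1 ≤ j → j < ℓ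
                        → j ∈ˢ X → suc j ∈ˢ X → ⊥
  expressible⇒¬adjacent {j = j} (_ , unique) 1≤j j<ℓ j∈X 1+j∈X
    with sameInterval 1≤j (n≤1+n j) j<ℓ (noBreakpointBetween-suc j)
  ... | p , q , I , j∈I , 1+j∈I =
    <-irrefl (unique p q I j (suc j) j∈X 1+j∈X j∈I 1+j∈I) (n<1+n j)

  close⇒¬far : ∀ {U X a j} → Close U X → 1 ≤ a → a < j → j < ℓ
             → NoBreakpointBetween a (suc j) → a ∈ˢ U → suc j ∈ˢ X → ⊥
  close⇒¬far {a = a} {j} close 1≤a a<j j<ℓ nb a∈U 1+j∈X
    with sameInterval 1≤a (≤-trans (<⇒≤ a<j) (n≤1+n j)) j<ℓ nb
  ... | p , q , I , a∈I , 1+j∈I =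
    2+n≤m⇒m∸n≰1 (s≤s a<j) (close p q I a (suc j) a∈U 1+j∈X a∈I 1+j∈I)

  close⇒withinOne : ∀ {S T} → Close T S → Close S T → WithinOne S T
  close⇒withinOne closeTS closeST p q I a b a∈S b∈T a∈I b∈I =
    closeTS p q I b a b∈T a∈S b∈I a∈I , closeST p q I a b a∈S b∈T a∈I b∈I

  withinOne⇒close : ∀ {S T} → WithinOne S T → Close T S × Close S T
  withinOne⇒close near =
    (λ p q I a b a∈T b∈S a∈I b∈I → proj₁ (near p q I b a b∈S a∈T b∈I a∈I)) ,
    (λ p q I a b a∈S b∈T a∈I b∈I → proj₂ (near p q I a b a∈S b∈T a∈I b∈I))

module Coordinates {c r : Level} (k : Field c r) where
  open Field k hiding (refl) renaming (sym to ≈-sym; trans to ≈-trans)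

  Pair : Set c
  Pair = Carrier × Carrier

  leftCoord rightCoord : Slope → Pair → Carrier
  leftCoord ↘  = proj₁
  leftCoord ↗  = proj₂
  rightCoord ↘ = proj₂
  rightCoord ↗ = proj₁

  EdgeEq : Slope → Pair → Pair → Set r
  EdgeEq s x x′ = leftCoord s x * rightCoord s x′ ≈ 0#

  SlopeEq⇒EdgeEq : ∀ s (P : Pt k) j → SlopeEq k s P j → EdgeEq s (P j) (P (suc j))
  SlopeEq⇒EdgeEq ↘ P j eq = eq
  SlopeEq⇒EdgeEq ↗ P j eq = eq

  EdgeEq⇒SlopeEq : ∀ s (P : Pt k) j → EdgeEq s (P j) (P (suc j)) → SlopeEq k s P j
  EdgeEq⇒SlopeEq ↘ P j eq = eq
  EdgeEq⇒SlopeEq ↗ P j eq = eq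

  Nonvanishing : Pair → Set r
  Nonvanishing x = ¬ (proj₁ x ≈ 0# × proj₂ x ≈ 0#)

  nonvanishing⇒coord≉0 : ∀ s {x} → Nonvanishing x → rightCoord s x ≈ 0# → ¬ (leftCoord s x ≈ 0#)
  nonvanishing⇒coord≉0 ↘ x≉0 ρ≈0 λ≈0 = x≉0 (λ≈0 , ρ≈0)
  nonvanishing⇒coord≉0 ↗ x≉0 ρ≈0 λ≈0 = x≉0 (ρ≈0 , λ≈0)

  before after : Slope → Pair
  before ↘ = 0# , 1#
  before ↗ = 1# , 0#
  after ↘  = 1# , 0#
  after ↗  = 0# , 1#

  after≡before : ∀ {s s′} → ¬ s ≡ s′ → after s ≡ before s′
  after≡before {↘} {↘} differ = contradiction refl differ
  after≡before {↘} {↗} _      = refl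
  after≡before {↗} {↘} _      = refl
  after≡before {↗} {↗} differ = contradiction refl differ

  before-nonvanishing : ∀ s → Nonvanishing (before s)
  before-nonvanishing ↘ (_ , 1≈0) = 1≉0 1≈0
  before-nonvanishing ↗ (1≈0 , _) = 1≉0 1≈0

  after-nonvanishing : ∀ s → Nonvanishing (after s)
  after-nonvanishing ↘ (1≈0 , _) = 1≉0 1≈0
  after-nonvanishing ↗ (_ , 1≈0) = 1≉0 1≈0

  EdgeEq-before : ∀ s x′ → EdgeEq s (before s) x′
  EdgeEq-before ↘ x′ = zeroˡ _
  EdgeEq-before ↗ x′ = zeroˡ _

  EdgeEq-after : ∀ s x → EdgeEq s x (after s)
  EdgeEq-after ↘ x = zeroʳ _
  EdgeEq-after ↗ x = zeroʳ _

  EdgeEq-from : ∀ {s x x′} → x ≡ before s ⊎ x′ ≡ after s → EdgeEq s x x′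
  EdgeEq-from {s} (inj₁ refl) = EdgeEq-before s _
  EdgeEq-from {s} (inj₂ refl) = EdgeEq-after s _

  EdgeEq-onesˡ : ∀ s x′ → EdgeEq s (1# , 1#) x′ → rightCoord s x′ ≈ 0#
  EdgeEq-onesˡ ↘ x′ eq = ≈-trans (≈-sym (*-identityˡ _)) eq
  EdgeEq-onesˡ ↗ x′ eq = ≈-trans (≈-sym (*-identityˡ _)) eq

  EdgeEq-onesʳ : ∀ s x → EdgeEq s x (1# , 1#) → leftCoord s x ≈ 0#
  EdgeEq-onesʳ ↘ x eq = ≈-trans (≈-sym (*-identityʳ _)) eq
  EdgeEq-onesʳ ↗ x eq = ≈-trans (≈-sym (*-identityʳ _)) eq

  x≉0∧x*y≈0⇒y≈0 : ∀ {x y} → ¬ (x ≈ 0#) → x * y ≈ 0# → y ≈ 0#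
  x≉0∧x*y≈0⇒y≈0 {x} {y} x≉0 xy≈0 with inverse x x≉0
  ... | x⁻¹ , xx⁻¹≈1 = begin
    y             ≈⟨ ≈-sym (*-identityˡ y) ⟩
    1# * y        ≈⟨ *-congʳ (≈-sym xx⁻¹≈1) ⟩
    (x * x⁻¹) * y ≈⟨ *-congʳ (*-comm x x⁻¹) ⟩
    (x⁻¹ * x) * y ≈⟨ *-assoc x⁻¹ x y ⟩
    x⁻¹ * (x * y) ≈⟨ *-congˡ xy≈0 ⟩
    x⁻¹ * 0#      ≈⟨ zeroʳ x⁻¹ ⟩
    0#            ∎
    where open ≈-Reasoning setoid

  rightCoord-propagates : ∀ {P : Pt k} s {m n}
    → (∀ {i} → m ≤ i → i < n → Nonvanishing (P i) × EdgeEq s (P i) (P (suc i)))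
    → m ≤′ n → rightCoord s (P m) ≈ 0# → rightCoord s (P n) ≈ 0#
  rightCoord-propagates _ _ ≤′-refl ρm≈0 = ρm≈0
  rightCoord-propagates {P} s {n = suc n} run (≤′-step m≤′n) ρm≈0 =
    x≉0∧x*y≈0⇒y≈0 (nonvanishing⇒coord≉0 s Pn≉0 ρn≈0) edgeₙ
    where
    Pn≉0 : Nonvanishing (P n)
    Pn≉0 = proj₁ (run (≤′⇒≤ m≤′n) ≤-refl)
    edgeₙ : EdgeEq s (P n) (P (suc n))
    edgeₙ = proj₂ (run (≤′⇒≤ m≤′n) ≤-refl)
    ρn≈0 : rightCoord s (P n) ≈ 0#
    ρn≈0 = rightCoord-propagates s (λ m≤i i<n → run m≤i (m<n⇒m<1+n i<n)) m≤′n ρm≈0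

  replace-∈ : ∀ X (P Q : Pt k) {i} → i ∈ˢ X → replace k X P Q i ≡ Q i
  replace-∈ X P Q i∈X rewrite i∈X = refl

  replace-∉ : ∀ X (P Q : Pt k) {i} → ¬ i ∈ˢ X → replace k X P Q i ≡ P i
  replace-∉ X P Q {i} i∉X with X i
  ... | true  = contradiction refl i∉X
  ... | false = refl

  replace-IsPoint : ∀ ℓ X {P Q : Pt k} → IsPoint k ℓ P → IsPoint k ℓ Q
                  → IsPoint k ℓ (replace k X P Q)
  replace-IsPoint ℓ X P-pt Q-pt i with X i
  ... | true  = Q-pt i
  ... | false = P-pt i

module CommonPoint {c r : Level} (k : Field c r) (ℓ : ℕ) (1≤ℓ : 1 ≤ ℓ) (t : ℕ → Slope) where
  open Field k using (_≈_; 0#; 1#; 1≉0)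
  open Coordinates k
  open Intervals ℓ t

  ones : Pt k
  ones _ = 1# , 1#

  ones-IsPoint : IsPoint k ℓ ones
  ones-IsPoint _ _ _ (1≈0 , _) = 1≉0 1≈0

  edge : ∀ {P} → InV k ℓ t P → ∀ {j} → 1 ≤ j → j < ℓ → EdgeEq (t j) (P j) (P (suc j))
  edge {P} (_ , eqs) {j} 1≤j j<ℓ = SlopeEq⇒EdgeEq (t j) P j (eqs j 1≤j (<⇒≤∸1 j<ℓ))

  separated⇒⊥ : ∀ {P X Y p q a b} → InVS k ℓ t X P → InVS k ℓ t Y P
    → Expressible ℓ t X → Expressible ℓ t Y → IsInterval ℓ t p q
    → a ∈ˢ X → suc b ∈ˢ Y → InInterval p q a → InInterval p q (suc b) → a < b → ⊥
  separated⇒⊥ {P} {X} {Y} {p} {q} {a} {b} (VP , freeX) (_ , freeY) (_ , uniqueX) (_ , uniqueY)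
    I@(bp , bq , _) a∈X 1+b∈Y (p≤a , a≤q) (p≤1+b , 1+b≤q) a<b =
    nonvanishing⇒coord≉0 s (point (<⇒≤ a<b) ≤-refl) ρb≈0 λb≈0
    where
    s : Slope
    s = t p
    1≤a : 1 ≤ a
    1≤a = ≤-trans (proj₁ (breakpoint-bounds 1≤ℓ bp)) p≤a
    b<ℓ : b < ℓ
    b<ℓ = <-≤-trans 1+b≤q (proj₂ (breakpoint-bounds 1≤ℓ bq))
    point : ∀ {i} → a ≤ i → i ≤ b → Nonvanishing (P i)
    point a≤i i≤b = proj₁ VP _ (≤-trans 1≤a a≤i) (≤-trans i≤b (<⇒≤ b<ℓ))
    edgeₛ : ∀ {R} → InV k ℓ t R → ∀ {i} → a ≤ i → i ≤ b → EdgeEq s (R i) (R (suc i))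
    edgeₛ VR a≤i i≤b = subst (λ s′ → EdgeEq s′ _ _)
      (interval-slope 1≤ℓ I (≤-trans p≤a a≤i) (<-≤-trans (s≤s i≤b) 1+b≤q))
      (edge VR (≤-trans 1≤a a≤i) (≤-<-trans i≤b b<ℓ))
    1+a∉X : ¬ suc a ∈ˢ X
    1+a∉X 1+a∈X = <-irrefl (uniqueX p q I a (suc a) a∈X 1+a∈X (p≤a , a≤q)
      (≤-trans p≤a (n≤1+n a) , ≤-trans a<b (≤-trans (n≤1+n b) 1+b≤q))) (n<1+n a)
    b∉Y : ¬ b ∈ˢ Y
    b∉Y b∈Y = <-irrefl (uniqueY p q I b (suc b) b∈Y 1+b∈Y
      (≤-trans p≤a (<⇒≤ a<b) , ≤-trans (n≤1+n b) 1+b≤q) (p≤1+b , 1+b≤q)) (n<1+n b)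
    ρ1+a≈0 : rightCoord s (P (suc a)) ≈ 0#
    ρ1+a≈0 = EdgeEq-onesˡ s _
      (subst₂ (EdgeEq s) (replace-∈ X P ones a∈X) (replace-∉ X P ones 1+a∉X)
        (edgeₛ (freeX ones ones-IsPoint) ≤-refl (<⇒≤ a<b)))
    ρb≈0 : rightCoord s (P b) ≈ 0#
    ρb≈0 = rightCoord-propagates s
      (λ 1+a≤i i<b → point (<⇒≤ 1+a≤i) (<⇒≤ i<b) , edgeₛ VP (<⇒≤ 1+a≤i) (<⇒≤ i<b))
      (≤⇒≤′ a<b) ρ1+a≈0
    λb≈0 : leftCoord s (P b) ≈ 0#
    λb≈0 = EdgeEq-onesʳ s _
      (subst₂ (EdgeEq s) (replace-∉ Y P ones b∉Y) (replace-∈ Y P ones 1+b∈Y)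
        (edgeₛ (freeY ones ones-IsPoint) (<⇒≤ a<b) ≤-refl))

  commonPoint⇒close : ∀ {P X Y} → InVS k ℓ t X P → InVS k ℓ t Y P
    → Expressible ℓ t X → Expressible ℓ t Y → Close X Y
  commonPoint⇒close P∈X P∈Y exX exY p q I a b a∈X b∈Y a∈I b∈I with m∸n≤1⊎2+n≤m b a
  ... | inj₁ b∸a≤1      = b∸a≤1
  ... | inj₂ (s≤s a<b′) = ⊥-elim (separated⇒⊥ P∈X P∈Y exX exY I a∈X b∈Y a∈I b∈I a<b′)

module Witness {c r : Level} (k : Field c r) (ℓ : ℕ) (t : ℕ → Slope) (U : ℕ → Bool) where
  open Coordinates k
  open Intervals ℓ t

  -- passed j holds iff some a ∈ U with 1 ≤ a < j has t a = t (a + 1) = ⋯ = t j.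
  passed : ℕ → Bool
  passed zero          = false
  passed (suc zero)    = false
  passed (suc (suc n)) = does (t (suc n) ≟ˢ t (2 + n)) ∧ (passed (suc n) ∨ U (suc n))

  witness : Pt k
  witness j = if passed j then after (t j) else before (t j)

  witness-IsPoint : IsPoint k ℓ witness
  witness-IsPoint j _ _ with passed j
  ... | true  = after-nonvanishing (t j)
  ... | false = before-nonvanishing (t j)

  witness-before : ∀ {j} → ¬ passed j ≡ true → witness j ≡ before (t j)
  witness-before {j} ¬passed with passed j
  ... | true  = contradiction refl ¬passed
  ... | false = refl

  witness-after : ∀ n → passed (suc n) ∨ U (suc n) ≡ true → witness (2 + n) ≡ after (t (suc n))
  witness-after n passed∨U with t (suc n) ≟ˢ t (2 + n)
  ... | yes same rewrite passed∨U = cong after (sym same)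
  ... | no differ = sym (after≡before differ)

  passed-source : ∀ n → suc n < ℓ → passed (suc n) ≡ true
                → ∃[ a ] (1 ≤ a × a < suc n × a ∈ˢ U × NoBreakpointBetween a (2 + n))
  passed-source zero    _     ()
  passed-source (suc n) 2+n<ℓ passed≡true with t (suc n) ≟ˢ t (2 + n) | U (suc n) in 1+n∈U
  passed-source (suc n) _     () | no _ | _
  ... | yes same | true  =
    suc n , s≤s z≤n , ≤-refl , 1+n∈U ,
    noBreakpointBetween-extendʳ (noBreakpointBetween-suc (suc n))
                                (sameSlope⇒¬breakpoint n 2+n<ℓ same)
  ... | yes same | false with passed-source n (<-trans (n<1+n _) 2+n<ℓ)
                                (trans (sym (∨-identityʳ _)) passed≡true)
  ...   | a , 1≤a , a<1+n , a∈U , nb =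
    a , 1≤a , m<n⇒m<1+n a<1+n , a∈U ,
    noBreakpointBetween-extendʳ nb (sameSlope⇒¬breakpoint n 2+n<ℓ same)

  witness-edge : ∀ {j} → 1 ≤ j → EdgeEq (t j) (witness j) (witness (suc j))
  witness-edge {suc n} _ with passed (suc n) ≟ᵇ true
  ... | yes passed₁ = EdgeEq-from (inj₂ (witness-after n (cong (_∨ U (suc n)) passed₁)))
  ... | no ¬passed₁ = EdgeEq-from (inj₁ (witness-before ¬passed₁))

  witness-InV : InV k ℓ t witness
  witness-InV =
    witness-IsPoint , λ j 1≤j _ → EdgeEq⇒SlopeEq (t j) witness j (witness-edge 1≤j)

  witness-InVS : ∀ {X} → Expressible ℓ t X → (∀ {i} → i ∈ˢ X → i ∈ˢ U) → Close U X
               → InVS k ℓ t X witness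
  witness-InVS {X} exX X⊆U close = witness-InV , λ Q Q-pt →
      replace-IsPoint ℓ X witness-IsPoint Q-pt
    , λ j 1≤j j≤ℓ∸1 → EdgeEq⇒SlopeEq (t j) _ j (replaced-edge Q 1≤j (≤∸1⇒< 1≤j j≤ℓ∸1))
    where
    replaced-edge : ∀ Q {j} → 1 ≤ j → j < ℓ
                  → EdgeEq (t j) (replace k X witness Q j) (replace k X witness Q (suc j))
    replaced-edge Q {suc n} 1≤j 1+n<ℓ with X (suc n) in 1+n∈X | X (2 + n) in 2+n∈X
    ... | true  | true  = ⊥-elim (expressible⇒¬adjacent exX 1≤j 1+n<ℓ 1+n∈X 2+n∈X)
    ... | true  | false = EdgeEq-from (inj₂ (witness-after n passed∨U))
      where
      passed∨U : passed (suc n) ∨ U (suc n) ≡ true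
      passed∨U = subst (λ u → passed (suc n) ∨ u ≡ true) (sym (X⊆U 1+n∈X)) (∨-zeroʳ _)
    ... | false | true  = EdgeEq-from (inj₁ (witness-before ¬passed₁))
      where
      ¬passed₁ : ¬ passed (suc n) ≡ true
      ¬passed₁ passed₁ with passed-source n 1+n<ℓ passed₁
      ... | a , 1≤a , a<1+n , a∈U , nb = close⇒¬far close 1≤a a<1+n 1+n<ℓ nb a∈U 2+n∈X
    ... | false | false = witness-edge 1≤j

proposition4p3p1 : {c r : Level} (k : Field c r) (ℓ : ℕ) → 1 ≤ ℓ → (t : ℕ → Slope)
    → (S T : ℕ → Bool) → MaximalExpressible ℓ t S → MaximalExpressible ℓ t T
    → (∃[ P ] (InVS k ℓ t S P × InVS k ℓ t T P))
      ⇔ (∀ p q → IsInterval ℓ t p q → ∀ a b → a ∈ˢ S → b ∈ˢ T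
           → InInterval p q a → InInterval p q b → (a ∸ b ≤ 1 × b ∸ a ≤ 1))
proposition4p3p1 k ℓ 1≤ℓ t S T (expS , _) (expT , _) = mk⇔ common⇒near near⇒common
  where
  open Intervals ℓ t
  open CommonPoint k ℓ 1≤ℓ t using (commonPoint⇒close)
  open Witness k ℓ t (λ i → S i ∨ T i) using (witness; witness-InVS)

  common⇒near : ∃[ P ] (InVS k ℓ t S P × InVS k ℓ t T P) → WithinOne S T
  common⇒near (P , P∈S , P∈T) =
    close⇒withinOne (commonPoint⇒close P∈T P∈S expT expS)
                    (commonPoint⇒close P∈S P∈T expS expT)

  near⇒common : WithinOne S T → ∃[ P ] (InVS k ℓ t S P × InVS k ℓ t T P)
  near⇒common near =
      witness
    , witness-InVS expS (λ {i} i∈S → cong (_∨ T i) i∈S)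
                   (close-∪ (expressible⇒close expS) closeTS)
    , witness-InVS expT (λ {i} i∈T → trans (cong (S i ∨_) i∈T) (∨-zeroʳ (S i)))
                   (close-∪ closeST (expressible⇒close expT))
    where
    closeTS : Close T S
    closeTS = proj₁ (withinOne⇒close near)
    closeST : Close S T
    closeST = proj₂ (withinOne⇒close near)
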